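{- Let $a,b$ be positive coprime integers with $a\ge b$, let $r$ be a positive integer and $b'=ra+b$. Let $D$ and $D'$ be the Euclidean designs of $a$ generated by $b$ and by $b'$, respectively. Then $D$ is a primitive design, $D'=0^rD$ (the word $D$ preceded by $r$ zeros), and the design numbers of $D$ and $D'$ are equal.
   Context: Designs: for $0\le m\le 2^n-1$, $\{m\}_n$ denotes the binary word $d_1\cdots d_n$ of length $n$ with $\sum 2^{n-i}d_i=m$; $m$ is its design number. $x^k$ denotes $k$ copies of the letter $x$. A design $\{m\}_n$ is primitive if $m$ is odd and $2^{n-1}\le m\le 2^n-1$ (i.e. the word is nonempty, begins with $1$ and ends with $1$). Partial quotients: for positive coprime $a,b$, the Euclidean algorithm $c_{i-2}=c_{i-1}r_i+c_i$ ($i=0,\dots,t-1$), $c_{ -2}=a$, $c_{ -1}=b$, $0\le c_i<c_{i-1}$, terminating with $c_{t-2}=1$, $c_{t-1}=0$, gives the partial quotients $r_0\ge 0, r_1,\dots,r_{t-1}\ge1$ of $a$ generated by $b$. Euclidean design of $a$ generated by $b$ (with $n=\sum r_i$): the word $1$ if $(a,b)=(1,1)$; $1^{r_0}0^{r_1}\cdots0^{r_{t-2}}1^{r_{t-1}}$ if $(a,b)\neq(1,1)$ and $t$ odd; $1^{r_0}0^{r_1}\cdots1^{r_{t-2}}0^{r_{t-1}-1}1$ if $(a,b)\ne(1,1)$ and $t$ even. -}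

module Defs where

open import Data.Nat using (ℕ; zero; suc; _+_; _*_; _∸_; _^_; _≤_; _/_; _%_)
open import Data.Nat.Properties using (_≟_)
open import Data.Bool using (Bool; true; false)
open import Data.List using (List; []; _∷_; _++_; replicate; length; foldl)
open import Data.Product using (_×_)
open import Relation.Nullary using (yes; no; ¬_)
open import Relation.Binary.PropositionalEquality using (_≡_)

-- A word over {0,1}: true = letter 1, false = letter 0.
Word : Set
Word = List Bool

bit : Bool → ℕ
bit true  = 1
bit false = 0

-- design number: m = Σ 2^{n-i} d_i for the word d_1 ⋯ d_n
designNumber : Word → ℕ
designNumber = foldl (λ acc d → 2 * acc + bit d) 0

Odd : ℕ → Set
Odd m = m % 2 ≡ 1

Primitive : Word → Set
Primitive w = Odd (designNumber w)
            × (2 ^ (length w ∸ 1) ≤ designNumber w)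
            × (designNumber w ≤ 2 ^ length w ∸ 1)

-- The second argument
-- strictly decreases at each step, so fuel (suc b) always suffices.
quotientsFuel : ℕ → ℕ → ℕ → List ℕ
quotientsFuel zero       a b       = []
quotientsFuel (suc f)    a zero    = []
quotientsFuel (suc f)    a (suc b) = (a / suc b) ∷ quotientsFuel f (suc b) (a % suc b)

partialQuotients : ℕ → ℕ → List ℕ
partialQuotients a b = quotientsFuel (suc b) a b

-- blocks 1^{r_0} 0^{r_1} 1^{r_2} ⋯ ; the flag says which letter the current block uses.
-- The last block (index t-1) is written plainly if it is a 1-block (t odd),
-- and as 0^{r_{t-1}-1} 1 if it is a 0-block (t even).
blocks : Bool → List ℕ → Word
blocks c []           = []
blocks true  (r ∷ []) = replicate r true
blocks false (r ∷ []) = replicate (r ∸ 1) false ++ (true ∷ [])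
blocks c     (r ∷ rs@(_ ∷ _)) = replicate r c ++ blocks (not c) rs
  where
    not : Bool → Bool
    not true  = false
    not false = true

euclideanDesign : ℕ → ℕ → Word
euclideanDesign a b with a ≟ 1 | b ≟ 1
... | yes _ | yes _ = true ∷ []
... | _     | _     = blocks true (partialQuotients a b)

{-# OPTIONS --safe #-}
module Submission where

-- The Euclidean algorithm on a and b′ = r a + b first produces the quotients 0 and r
-- and then continues exactly as on a and b (when b = a it stops at r + 1 instead).
-- In the block encoding the leading 0 is an empty 1-block, so D′ is D preceded by a
-- 0-block of length r, and leading zeros do not change a design number.  Since b ≤ a,
-- every partial quotient of a generated by b is positive, so D begins and ends with 1,
-- which makes it primitive.

open import Defs
open import Data.Nat using (ℕ; zero; suc; _+_; _*_; _∸_; _^_; _≤_; _<_; _≥_; _/_; _%_; NonZero; >-nonZero; z≤n; s≤s)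
open import Data.Nat.Properties
open import Data.Nat.DivMod
open import Data.Nat.Divisibility using (n∣m*n)
open import Data.Nat.Coprimality using (Coprime)
open import Data.Nat.Tactic.RingSolver using (solve-∀)
open import Data.Bool using (Bool; true; false; not)
open import Data.List using ([]; _∷_; _∷ʳ_; replicate; _++_; length; foldl)
open import Data.List.Properties using (foldl-++; ++-assoc)
open import Data.List.Relation.Unary.All using (All; []; _∷_)
open import Data.Sum using (_⊎_; inj₁; inj₂)
open import Data.Product using (_×_; _,_; ∃)
open import Relation.Nullary using (yes; no)
open import Relation.Binary.PropositionalEquality

quotientsFuel-irrelevant : ∀ f h x y → y < f → y < h → quotientsFuel f x y ≡ quotientsFuel h x y
quotientsFuel-irrelevant (suc f) (suc h) x zero    _       _       = refl
quotientsFuel-irrelevant (suc f) (suc h) x (suc y) (s≤s p) (s≤s q) =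
  cong (x / suc y ∷_) (quotientsFuel-irrelevant f h (suc y) (x % suc y)
    (≤-trans (m%n<n x (suc y)) p) (≤-trans (m%n<n x (suc y)) q))

quotientsFuel-positive : ∀ f x y → y ≤ x → All (1 ≤_) (quotientsFuel f x y)
quotientsFuel-positive zero    x zero    _   = []
quotientsFuel-positive zero    x (suc y) _   = []
quotientsFuel-positive (suc f) x zero    _   = []
quotientsFuel-positive (suc f) x (suc y) y≤x =
  m≥n⇒m/n>0 y≤x ∷ quotientsFuel-positive f (suc y) (x % suc y) (<⇒≤ (m%n<n x (suc y)))

partialQuotients-positive : ∀ x y → y ≤ x → All (1 ≤_) (partialQuotients x y)
partialQuotients-positive x y = quotientsFuel-positive (suc y) x y

partialQuotients-unfold : ∀ x y .{{_ : NonZero y}} →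
  partialQuotients x y ≡ x / y ∷ partialQuotients y (x % y)
partialQuotients-unfold x (suc y) = cong (x / suc y ∷_)
  (quotientsFuel-irrelevant (suc y) (suc (x % suc y)) (suc y) (x % suc y) (m%n<n x (suc y)) ≤-refl)

partialQuotients-< : ∀ {x y} → x < y → partialQuotients x y ≡ 0 ∷ partialQuotients y x
partialQuotients-< {x} {y} x<y = begin
  partialQuotients x y               ≡⟨ partialQuotients-unfold x y ⟩
  x / y ∷ partialQuotients y (x % y) ≡⟨ cong₂ (λ q m → q ∷ partialQuotients y m) (m<n⇒m/n≡0 x<y) (m<n⇒m%n≡m x<y) ⟩
  0 ∷ partialQuotients y x           ∎
  where
  open ≡-Reasoning
  instance _ = >-nonZero (≤-trans (s≤s z≤n) x<y)

partialQuotients-self : ∀ x .{{_ : NonZero x}} → partialQuotients x x ≡ 1 ∷ []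
partialQuotients-self x = trans (partialQuotients-unfold x x)
  (cong₂ (λ q m → q ∷ partialQuotients x m) (n/n≡1 x) (n%n≡0 x))

partialQuotients-+* : ∀ r x y .{{_ : NonZero y}} →
  partialQuotients (r * y + x) y ≡ r + x / y ∷ partialQuotients y (x % y)
partialQuotients-+* r x y = begin
  partialQuotients (r * y + x) y                          ≡⟨ partialQuotients-unfold (r * y + x) y ⟩
  (r * y + x) / y ∷ partialQuotients y ((r * y + x) % y) ≡⟨ cong₂ (λ q m → q ∷ partialQuotients y m) quotient remainder ⟩
  r + x / y ∷ partialQuotients y (x % y)                  ∎
  where
  open ≡-Reasoning
  quotient : (r * y + x) / y ≡ r + x / y
  quotient = trans (+-distrib-/-∣ˡ x (n∣m*n r)) (cong (_+ x / y) (m*n/n≡m r y))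
  remainder : (r * y + x) % y ≡ x % y
  remainder = trans (cong (_% y) (+-comm (r * y) x)) ([m+kn]%n≡m%n x r y)

euclideanDesign≡blocks : ∀ a b → euclideanDesign a b ≡ blocks true (partialQuotients a b)
euclideanDesign≡blocks a b with a ≟ 1 | b ≟ 1
... | yes refl | yes refl = refl
... | yes _    | no _     = refl
... | no _     | _        = refl

blocks-∷-∷ : ∀ c r r′ rs → blocks c (r ∷ r′ ∷ rs) ≡ replicate r c ++ blocks (not c) (r′ ∷ rs)
blocks-∷-∷ true  r r′ rs = refl
blocks-∷-∷ false r r′ rs = refl

replicate-suc-∷ʳ : ∀ n (x : Bool) → replicate (suc n) x ≡ replicate n x ∷ʳ x
replicate-suc-∷ʳ zero    x = refl
replicate-suc-∷ʳ (suc n) x = cong (x ∷_) (replicate-suc-∷ʳ n x)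

blocks-endsWithOne : ∀ c q qs → All (1 ≤_) (q ∷ qs) → ∃ λ u → blocks c (q ∷ qs) ≡ u ∷ʳ true
blocks-endsWithOne true  (suc q) []        _ = replicate q true , replicate-suc-∷ʳ q true
blocks-endsWithOne false q       []        _ = replicate (q ∸ 1) false , refl
blocks-endsWithOne c     q       (q′ ∷ qs) (_ ∷ positive)
  with blocks-endsWithOne (not c) q′ qs positive
... | u , ends = replicate q c ++ u , (begin
  blocks c (q ∷ q′ ∷ qs)                    ≡⟨ blocks-∷-∷ c q q′ qs ⟩
  replicate q c ++ blocks (not c) (q′ ∷ qs) ≡⟨ cong (replicate q c ++_) ends ⟩
  replicate q c ++ (u ∷ʳ true)              ≡⟨ ++-assoc (replicate q c) u (true ∷ []) ⟨
  (replicate q c ++ u) ∷ʳ true              ∎)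
  where open ≡-Reasoning

blocks-beginsWithOne : ∀ q qs → 1 ≤ q → ∃ λ u → blocks true (q ∷ qs) ≡ true ∷ u
blocks-beginsWithOne (suc q) []        _ = replicate q true , refl
blocks-beginsWithOne (suc q) (q′ ∷ qs) _ = replicate q true ++ blocks false (q′ ∷ qs) , refl

pushBit : ℕ → Bool → ℕ
pushBit acc d = 2 * acc + bit d

foldl-pushBit : ∀ acc w → foldl pushBit acc w ≡ acc * 2 ^ length w + designNumber w
foldl-pushBit acc []      = sym (trans (+-identityʳ (acc * 1)) (*-identityʳ acc))
foldl-pushBit acc (d ∷ w) = begin
  foldl pushBit (2 * acc + bit d) w
    ≡⟨ foldl-pushBit (2 * acc + bit d) w ⟩
  (2 * acc + bit d) * 2 ^ length w + designNumber w
    ≡⟨ shift acc (bit d) (2 ^ length w) (designNumber w) ⟩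
  acc * (2 * 2 ^ length w) + (bit d * 2 ^ length w + designNumber w)
    ≡⟨ cong (acc * 2 ^ suc (length w) +_) (foldl-pushBit (bit d) w) ⟨
  acc * 2 ^ suc (length w) + foldl pushBit (bit d) w
    ∎
  where
  open ≡-Reasoning
  shift : ∀ acc b p n → (2 * acc + b) * p + n ≡ acc * (2 * p) + (b * p + n)
  shift = solve-∀

designNumber-∷ : ∀ d w → designNumber (d ∷ w) ≡ bit d * 2 ^ length w + designNumber w
designNumber-∷ d w = foldl-pushBit (bit d) w

designNumber-++ : ∀ u w → designNumber (u ++ w) ≡ designNumber u * 2 ^ length w + designNumber w
designNumber-++ u w = trans (foldl-++ pushBit 0 u w) (foldl-pushBit (designNumber u) w)

designNumber-replicate-false : ∀ n → designNumber (replicate n false) ≡ 0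
designNumber-replicate-false zero    = refl
designNumber-replicate-false (suc n) = designNumber-replicate-false n

designNumber-leadingZeros : ∀ n w → designNumber (replicate n false ++ w) ≡ designNumber w
designNumber-leadingZeros n w = trans (designNumber-++ (replicate n false) w)
  (cong (λ m → m * 2 ^ length w + designNumber w) (designNumber-replicate-false n))

designNumber-< : ∀ w → designNumber w < 2 ^ length w
designNumber-< []      = s≤s z≤n
designNumber-< (d ∷ w) = begin-strict
  designNumber (d ∷ w)                  ≡⟨ designNumber-∷ d w ⟩
  bit d * 2 ^ length w + designNumber w ≤⟨ +-monoˡ-≤ (designNumber w) (*-monoˡ-≤ (2 ^ length w) (bit≤1 d)) ⟩
  1 * 2 ^ length w + designNumber w     <⟨ +-monoʳ-< (1 * 2 ^ length w) (designNumber-< w) ⟩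
  1 * 2 ^ length w + 2 ^ length w       ≡⟨ +-comm (1 * 2 ^ length w) (2 ^ length w) ⟩
  2 ^ suc (length w)                    ∎
  where
  open ≤-Reasoning
  bit≤1 : ∀ e → bit e ≤ 1
  bit≤1 true  = ≤-refl
  bit≤1 false = z≤n

designNumber-∷ʳ-true-odd : ∀ u → Odd (designNumber (u ∷ʳ true))
designNumber-∷ʳ-true-odd u = begin
  designNumber (u ++ true ∷ []) % 2 ≡⟨ cong (_% 2) (designNumber-++ u (true ∷ [])) ⟩
  (designNumber u * 2 + 1) % 2      ≡⟨ cong (_% 2) (+-comm (designNumber u * 2) 1) ⟩
  (1 + designNumber u * 2) % 2      ≡⟨ [m+kn]%n≡m%n 1 (designNumber u) 2 ⟩
  1                                 ∎
  where open ≡-Reasoning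

beginsEndsWithOne⇒Primitive : ∀ {w} u v → w ≡ true ∷ u → w ≡ v ∷ʳ true → Primitive w
beginsEndsWithOne⇒Primitive {w} u v refl w≡v1 = odd , lower , upper
  where
  odd : Odd (designNumber w)
  odd = subst (λ x → Odd (designNumber x)) (sym w≡v1) (designNumber-∷ʳ-true-odd v)
  lower : 2 ^ length u ≤ designNumber w
  lower = begin
    2 ^ length u                         ≡⟨ *-identityˡ (2 ^ length u) ⟨
    1 * 2 ^ length u                     ≤⟨ m≤m+n (1 * 2 ^ length u) (designNumber u) ⟩
    1 * 2 ^ length u + designNumber u    ≡⟨ designNumber-∷ true u ⟨
    designNumber (true ∷ u)              ∎
    where open ≤-Reasoning
  upper : designNumber w ≤ 2 ^ length w ∸ 1
  upper = <⇒≤∸1 (designNumber-< w)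
    where
    <⇒≤∸1 : ∀ {m n} → m < n → m ≤ n ∸ 1
    <⇒≤∸1 (s≤s m≤n) = m≤n

blocks-primitive : ∀ q qs → All (1 ≤_) (q ∷ qs) → Primitive (blocks true (q ∷ qs))
blocks-primitive q qs positive@(1≤q ∷ _)
  with blocks-beginsWithOne q qs 1≤q | blocks-endsWithOne true q qs positive
... | u , begins | v , ends = beginsEndsWithOne⇒Primitive u v begins ends

euclideanDesign-primitive : ∀ a b → 1 ≤ b → b ≤ a → Primitive (euclideanDesign a b)
euclideanDesign-primitive a b@(suc _) _ b≤a = subst Primitive (sym design)
  (blocks-primitive (a / b) _ (subst (All (1 ≤_)) unfold (partialQuotients-positive a b b≤a)))
  where
  unfold : partialQuotients a b ≡ a / b ∷ partialQuotients b (a % b)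
  unfold = partialQuotients-unfold a b
  design : euclideanDesign a b ≡ blocks true (a / b ∷ partialQuotients b (a % b))
  design = trans (euclideanDesign≡blocks a b) (cong (blocks true) unfold)

partialQuotients-shift : ∀ a b r .{{_ : NonZero a}} → 1 ≤ b →
  partialQuotients a (suc r * a + b) ≡ 0 ∷ suc r + b / a ∷ partialQuotients a (b % a)
partialQuotients-shift a b r 1≤b =
  trans (partialQuotients-< a<b′) (cong (0 ∷_) (partialQuotients-+* (suc r) b a))
  where
  a<b′ : a < suc r * a + b
  a<b′ = ≤-trans (≤-reflexive (+-comm 1 a)) (+-mono-≤ (m≤m+n a (r * a)) 1≤b)

euclideanDesign-shift : ∀ a b r → 1 ≤ b → b ≤ a →
  euclideanDesign a (r * a + b) ≡ replicate r false ++ euclideanDesign a b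
euclideanDesign-shift a           b         zero    _   _   = refl
euclideanDesign-shift a@(suc _) b@(suc _) (suc r) 1≤b b≤a = begin
  euclideanDesign a (suc r * a + b)                              ≡⟨ euclideanDesign≡blocks a _ ⟩
  blocks true (partialQuotients a (suc r * a + b))               ≡⟨ cong (blocks true) (partialQuotients-shift a b r 1≤b) ⟩
  blocks true (0 ∷ suc r + b / a ∷ partialQuotients a (b % a))   ≡⟨ leadingZeroBlock (m≤n⇒m<n∨m≡n b≤a) ⟩
  replicate (suc r) false ++ blocks true (partialQuotients a b)  ≡⟨ cong (replicate (suc r) false ++_) (euclideanDesign≡blocks a b) ⟨
  replicate (suc r) false ++ euclideanDesign a b                 ∎
  where
  open ≡-Reasoning
  leadingZeroBlock : b < a ⊎ b ≡ a →
    blocks true (0 ∷ suc r + b / a ∷ partialQuotients a (b % a)) ≡ replicate (suc r) false ++ blocks true (partialQuotients a b)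
  leadingZeroBlock (inj₁ b<a)
    rewrite m<n⇒m/n≡0 b<a | m<n⇒m%n≡m b<a | +-identityʳ r = refl
  leadingZeroBlock (inj₂ refl) = begin
    blocks true (0 ∷ suc r + a / a ∷ partialQuotients a (a % a))  ≡⟨ cong₂ (λ q m → blocks true (0 ∷ suc r + q ∷ partialQuotients a m)) (n/n≡1 a) (n%n≡0 a) ⟩
    blocks true (0 ∷ suc (r + 1) ∷ [])                             ≡⟨ cong (λ k → blocks true (0 ∷ suc k ∷ [])) (+-comm r 1) ⟩
    replicate (suc r) false ++ blocks true (1 ∷ [])                ≡⟨ cong (λ qs → replicate (suc r) false ++ blocks true qs) (partialQuotients-self a) ⟨
    replicate (suc r) false ++ blocks true (partialQuotients a a)  ∎

theorem3p9 : (a b r : ℕ) → 1 ≤ a → 1 ≤ b → Coprime a b → a ≥ b → 1 ≤ r →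
    Primitive (euclideanDesign a b)
    × euclideanDesign a (r * a + b) ≡ replicate r false ++ euclideanDesign a b
    × designNumber (euclideanDesign a (r * a + b)) ≡ designNumber (euclideanDesign a b)
theorem3p9 a b r _ 1≤b _ b≤a _ =
  euclideanDesign-primitive a b 1≤b b≤a , shift ,
  trans (cong designNumber shift) (designNumber-leadingZeros r (euclideanDesign a b))
  where
  shift : euclideanDesign a (r * a + b) ≡ replicate r false ++ euclideanDesign a b
  shift = euclideanDesign-shift a b r 1≤b b≤a
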